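{- Let $n,k$ be integers with $n\geq 4k+6$, and let $G$ be a graph with an even number $n$ of vertices. Then $\mathrm{mp}(G)=n-k$ if and only if $\delta(G)=n-k$.
   Context: All graphs are finite, simple and undirected; $\delta(G)$ is the minimum degree. A perfect matching is a set of edges covering every vertex exactly once; an almost-perfect matching is a set of edges covering every vertex except one exactly once and missing the remaining vertex. The matching preclusion number $\mathrm{mp}(G)$ is the minimum number of edges whose deletion leaves a graph with neither a perfect matching nor an almost-perfect matching ($\mathrm{mp}(G)=0$ if $G$ has neither). -}

module Defs where

open import Data.Nat using (ℕ; zero; suc; _+_; _≤_)
open import Data.Bool using (Bool; true; false; if_then_else_; _∧_; not; T)
open import Data.Fin using (Fin; toℕ)
open import Data.List using (List; map; allFin)
open import Data.Nat.ListAction using (sum)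
open import Data.Sum using (_⊎_)
open import Data.Product using (Σ; ∃; _×_; _,_)
open import Relation.Binary.PropositionalEquality using (_≡_; _≢_)
open import Relation.Nullary using (¬_)
open import Relation.Nullary.Decidable using (⌊_⌋)
import Data.Nat as ℕ

record Graph (n : ℕ) : Set where
  field
    adj    : Fin n → Fin n → Bool
    sym    : ∀ i j → adj i j ≡ adj j i
    irrefl : ∀ i → adj i i ≡ false
open Graph public

count : {n : ℕ} → (Fin n → Bool) → ℕ
count {n} p = sum (map (λ j → if p j then 1 else 0) (allFin n))

deg : {n : ℕ} → Graph n → Fin n → ℕ
deg G v = count (adj G v)

IsMinDegree : {n : ℕ} → Graph n → ℕ → Set
IsMinDegree {n} G d = (Σ (Fin n) λ v → deg G v ≡ d) × (∀ v → d ≤ deg G v)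

_⊆ᴳ_ : {n : ℕ} → Graph n → Graph n → Set
H ⊆ᴳ G = ∀ i j → T (adj H i j) → T (adj G i j)

-- number of edges of G not in H (each unordered edge {i,j} counted once, via i < j)
deletedEdges : {n : ℕ} → Graph n → Graph n → ℕ
deletedEdges {n} G H =
  sum (map (λ i → count (λ j → ⌊ toℕ i ℕ.<? toℕ j ⌋ ∧ adj G i j ∧ not (adj H i j))) (allFin n))

-- A matching M (an edge set, represented as a graph) is perfect in H
IsPerfectMatching : {n : ℕ} → Graph n → Graph n → Set
IsPerfectMatching H M = M ⊆ᴳ H × (∀ v → deg M v ≡ 1)

IsAlmostPerfectMatching : {n : ℕ} → Graph n → Graph n → Set
IsAlmostPerfectMatching {n} H M =
  M ⊆ᴳ H × (Σ (Fin n) λ u → deg M u ≡ 0 × (∀ v → v ≢ u → deg M v ≡ 1))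

HasPMorAPM : {n : ℕ} → Graph n → Set
HasPMorAPM {n} H = Σ (Graph n) λ M → IsPerfectMatching H M ⊎ IsAlmostPerfectMatching H M

-- mp(G) = m : m is the minimum number of edges whose deletion from G leaves a graph
-- with neither a perfect nor an almost-perfect matching (m = 0 if G itself has neither).
IsMatchingPreclusionNumber : {n : ℕ} → Graph n → ℕ → Set
IsMatchingPreclusionNumber {n} G m =
  (Σ (Graph n) λ H → H ⊆ᴳ G × ¬ HasPMorAPM H × deletedEdges G H ≡ m)
  × (∀ H → H ⊆ᴳ G → ¬ HasPMorAPM H → m ≤ deletedEdges G H)

module Submission where

-- With m = n − k the hypothesis reads 3n + 6 ≤ 4m. Isolating a vertex v (deleting its deg(v) edges)
-- destroys every perfect and almost-perfect matching, so mp(G) ≤ δ(G). The heart of the proof is the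
-- converse, `RobustMatching.perfect-matching`: if δ(G) ≥ δ and 3n + 6 ≤ 4δ, then deleting fewer than
-- δ edges leaves a graph H with a perfect matching. Call a vertex poor if at most half of the vertices
-- are its H-neighbours; counting degrees shows that every vertex keeps an H-neighbour and at most two
-- vertices are poor. Starting from any pairing of the vertices we repeatedly rematch a badly paired
-- vertex a with an H-neighbour x, pairing the old partners of a and x with each other: first for poor a,
-- choosing x with a rich partner, then for all a, choosing x by pigeonhole so that both new pairs are
-- H-edges. Each rematching lowers the number of badly paired vertices of the kind being fixed, so the
-- process ends with a perfect matching of H. Hence mp(G) = δ(G) whenever 4δ(G) ≥ 3n + 6, which gives
-- both directions of the theorem.

module Booleans where

  open import Data.Bool using (true; false; _∧_)
  open import Data.Product using (_×_; _,_)
  open import Relation.Nullary using (Dec; does; yes; no; ¬_)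
  open import Relation.Binary.PropositionalEquality using (_≡_; _≢_; refl)

  true≢false : true ≢ false
  true≢false ()

  ∧-true : ∀ {a b} → a ∧ b ≡ true → a ≡ true × b ≡ true
  ∧-true {true} b≡true = refl , b≡true

  does-true : ∀ {P : Set} (P? : Dec P) → does P? ≡ true → P
  does-true (yes p) _ = p

  does-false : ∀ {P : Set} (P? : Dec P) → does P? ≡ false → ¬ P
  does-false (no ¬p) _ = ¬p

module Counting where

  open import Data.Nat using (ℕ; zero; suc; _+_; _≤_; _<_; z≤n; s≤s)
  open import Data.Nat.Properties hiding (_≟_)
  open import Data.Bool using (Bool; true; false; if_then_else_; _∧_; not)
  open import Data.Fin using (Fin; zero; suc; _≟_)
  open import Data.List using (map; allFin; tabulate)
  open import Data.List.Properties using (map-tabulate)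
  import Data.Nat.ListAction as List
  open import Data.Product using (∃; _×_; _,_; proj₂)
  open import Function using (_∘_; id)
  open import Relation.Nullary using (does)
  open import Relation.Binary.PropositionalEquality
  open import Algebra.Properties.CommutativeMonoid.Sum +-0-commutativeMonoid
    using (sum; sum-syntax; sum-cong-≗; ∑-distrib-+)
  open import Defs using (count)
  open Booleans using (∧-true)

  𝟙 : Bool → ℕ
  𝟙 b = if b then 1 else 0

  #_ : ∀ {n} → (Fin n → Bool) → ℕ
  #_ {n} p = ∑[ i < n ] 𝟙 (p i)

  listSum≡∑ : ∀ {n} (f : Fin n → ℕ) → List.sum (map f (allFin n)) ≡ sum f
  listSum≡∑ {n} f = trans (cong List.sum (map-tabulate id f)) (tabulated f)
    where
    tabulated : ∀ {m} (f : Fin m → ℕ) → List.sum (tabulate f) ≡ sum f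
    tabulated {zero} f = refl
    tabulated {suc m} f = cong (f zero +_) (tabulated (f ∘ suc))

  count≡# : ∀ {n} (p : Fin n → Bool) → count p ≡ # p
  count≡# p = listSum≡∑ (𝟙 ∘ p)

  ∑-mono : ∀ {n} {f g : Fin n → ℕ} → (∀ i → f i ≤ g i) → sum f ≤ sum g
  ∑-mono {zero} le = z≤n
  ∑-mono {suc n} le = +-mono-≤ (le zero) (∑-mono (le ∘ suc))

  ∑-mono-< : ∀ {n} {f g : Fin n → ℕ} (u : Fin n) → (∀ i → f i ≤ g i) → f u < g u → sum f < sum g
  ∑-mono-< zero le lt = +-mono-<-≤ lt (∑-mono (le ∘ suc))
  ∑-mono-< (suc u) le lt = +-mono-≤-< (le zero) (∑-mono-< u (le ∘ suc) lt)

  ∑-pick : ∀ {n} (u : Fin n) (f : Fin n → ℕ) → ∑[ i < n ] (if does (i ≟ u) then f i else 0) ≡ f u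
  ∑-pick {suc n} zero f = trans (cong (f zero +_) (∑-zero n)) (+-identityʳ (f zero))
    where
    ∑-zero : ∀ m → ∑[ i < m ] 0 ≡ 0
    ∑-zero zero = refl
    ∑-zero (suc m) = ∑-zero m
  ∑-pick {suc n} (suc u) f = ∑-pick u (f ∘ suc)

  #-true : ∀ n → # (λ (_ : Fin n) → true) ≡ n
  #-true zero = refl
  #-true (suc n) = cong suc (#-true n)

  #-single : ∀ {n} (u : Fin n) → # (λ i → does (i ≟ u)) ≡ 1
  #-single u = ∑-pick u (λ _ → 1)

  #-mono : ∀ {n} {p q : Fin n → Bool} → (∀ i → p i ≡ true → q i ≡ true) → # p ≤ # q
  #-mono {p = p} {q} imp = ∑-mono (λ i → 𝟙-mono (p i) (q i) (imp i))
    where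
    𝟙-mono : ∀ a b → (a ≡ true → b ≡ true) → 𝟙 a ≤ 𝟙 b
    𝟙-mono false b _ = z≤n
    𝟙-mono true b ab rewrite ab refl = ≤-refl

  #-split : ∀ {n} (p c : Fin n → Bool) → # p ≡ # (λ i → p i ∧ c i) + # (λ i → p i ∧ not (c i))
  #-split {n} p c =
    trans (sum-cong-≗ (λ i → 𝟙-split (p i) (c i))) (∑-distrib-+ (λ i → 𝟙 (p i ∧ c i)) (λ i → 𝟙 (p i ∧ not (c i))))
    where
    𝟙-split : ∀ a b → 𝟙 a ≡ 𝟙 (a ∧ b) + 𝟙 (a ∧ not b)
    𝟙-split false b = refl
    𝟙-split true true = refl
    𝟙-split true false = refl

  #-without : ∀ {n} (p : Fin n → Bool) (u : Fin n) → # p ≤ # (λ i → p i ∧ not (does (i ≟ u))) + 1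
  #-without p u = begin
    # p                                                   ≡⟨ #-split p (λ i → does (i ≟ u)) ⟩
    # (λ i → p i ∧ does (i ≟ u)) + # without-u           ≤⟨ +-monoˡ-≤ (# without-u) at-most-u ⟩
    1 + # without-u                                       ≡⟨ +-comm 1 (# without-u) ⟩
    # without-u + 1                                       ∎
    where
    open ≤-Reasoning
    without-u = λ i → p i ∧ not (does (i ≟ u))
    at-most-u : # (λ i → p i ∧ does (i ≟ u)) ≤ 1
    at-most-u = subst (# (λ i → p i ∧ does (i ≟ u)) ≤_) (#-single u) (#-mono (λ i → proj₂ ∘ ∧-true {p i}))

  #≡0⇒false : ∀ {n} (p : Fin n → Bool) → # p ≡ 0 → ∀ i → p i ≡ false
  #≡0⇒false {suc n} p e zero with p zero
  ... | false = refl
  #≡0⇒false {suc n} p e (suc i) with p zero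
  ... | false = #≡0⇒false (p ∘ suc) e i

  #>0⇒witness : ∀ {n} (p : Fin n → Bool) → 0 < # p → ∃ λ i → p i ≡ true
  #>0⇒witness {suc n} p pos with p zero in e
  ... | true = zero , e
  ... | false with #>0⇒witness (p ∘ suc) pos
  ...   | i , pi = suc i , pi

  pigeonhole : ∀ {n} (p q : Fin n → Bool) → n < # p + # q → ∃ λ i → p i ≡ true × q i ≡ true
  pigeonhole {n} p q big with #>0⇒witness (λ i → p i ∧ q i) both-pos
    where
    ∧≤ : ∀ a b → 𝟙 a + 𝟙 b ≤ 𝟙 (a ∧ b) + 1
    ∧≤ true true = ≤-refl
    ∧≤ true false = ≤-refl
    ∧≤ false true = s≤s z≤n
    ∧≤ false false = z≤n
    bound : # p + # q ≤ # (λ i → p i ∧ q i) + n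
    bound = begin
      # p + # q                                 ≡⟨ ∑-distrib-+ (𝟙 ∘ p) (𝟙 ∘ q) ⟨
      ∑[ i < n ] (𝟙 (p i) + 𝟙 (q i))            ≤⟨ ∑-mono {n} (λ i → ∧≤ (p i) (q i)) ⟩
      ∑[ i < n ] (𝟙 (p i ∧ q i) + 1)            ≡⟨ ∑-distrib-+ {n} (λ i → 𝟙 (p i ∧ q i)) (λ _ → 1) ⟩
      # (λ i → p i ∧ q i) + ∑[ i < n ] 1        ≡⟨ cong (# (λ i → p i ∧ q i) +_) (#-true n) ⟩
      # (λ i → p i ∧ q i) + n                   ∎
      where open ≤-Reasoning
    both-pos : 0 < # (λ i → p i ∧ q i)
    both-pos = +-cancelʳ-< n 0 (# (λ i → p i ∧ q i)) (<-≤-trans big bound)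
  ... | i , piqi = i , ∧-true piqi

module EdgeCounting where

  open import Data.Nat using (ℕ; _+_; _≤_; _<_; _<?_; ⌊_/2⌋)
  open import Data.Nat.Properties hiding (_≟_)
  open import Data.Bool using (Bool; true; false; if_then_else_; _∧_; _∨_; not)
  open import Data.Bool.Properties using (∧-assoc; ∨-comm; ∧-identityʳ)
  open import Data.Fin using (Fin; _≟_; toℕ)
  open import Data.Fin.Properties using (toℕ-injective)
  open import Function using (_∘_)
  open import Relation.Nullary using (does; yes; no; ¬_)
  open import Relation.Nullary.Decidable using (⌊_⌋; isYes≗does; dec-true; dec-false)
  open import Relation.Binary.PropositionalEquality
  open import Relation.Binary.Definitions using (tri<; tri≈; tri>)
  open import Algebra.Properties.CommutativeMonoid.Sum +-0-commutativeMonoid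
    using (sum-syntax; sum-cong-≗; ∑-distrib-+; ∑-comm)
  open import Data.Nat.Solver using (module +-*-Solver)
  open +-*-Solver using (solve; _:+_; _:=_; con)
  open Counting

  Adjacency : ℕ → Set
  Adjacency n = Fin n → Fin n → Bool

  module _ {n : ℕ} where

    SymmetricAdj IrreflexiveAdj : Adjacency n → Set
    SymmetricAdj R = ∀ i j → R i j ≡ R j i
    IrreflexiveAdj R = ∀ i → R i i ≡ false

    degree : Adjacency n → Fin n → ℕ
    degree R v = # (R v)

    below : Fin n → Fin n → Bool
    below i j = ⌊ toℕ i <? toℕ j ⌋

    edges : Adjacency n → ℕ
    edges R = ∑[ i < n ] # (λ j → below i j ∧ R i j)

    below-true : ∀ {i j} → toℕ i < toℕ j → below i j ≡ true
    below-true {i} {j} i<j = trans (isYes≗does (toℕ i <? toℕ j)) (dec-true (toℕ i <? toℕ j) i<j)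

    below-false : ∀ {i j} → ¬ toℕ i < toℕ j → below i j ≡ false
    below-false {i} {j} i≮j = trans (isYes≗does (toℕ i <? toℕ j)) (dec-false (toℕ i <? toℕ j) i≮j)

    edges-cong : ∀ {R S : Adjacency n} → (∀ i j → R i j ≡ S i j) → edges R ≡ edges S
    edges-cong R≡S = sum-cong-≗ (λ i → sum-cong-≗ (λ j → cong (λ b → 𝟙 (below i j ∧ b)) (R≡S i j)))

    𝟙-halves : ∀ {R : Adjacency n} → IrreflexiveAdj R → ∀ i j →
               𝟙 (R i j) ≡ 𝟙 (below i j ∧ R i j) + 𝟙 (below j i ∧ R i j)
    𝟙-halves {R} irr i j with <-cmp (toℕ i) (toℕ j)
    ... | tri< i<j _ j≮i rewrite below-true i<j | below-false j≮i = sym (+-identityʳ _)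
    ... | tri> i≮j _ j<i rewrite below-false i≮j | below-true j<i = refl
    ... | tri≈ _ i≡j _ with toℕ-injective i≡j
    ...   | refl rewrite irr i | below-false {i} {i} (<-irrefl refl) = refl

    handshake : ∀ {R : Adjacency n} → SymmetricAdj R → IrreflexiveAdj R →
                ∑[ v < n ] degree R v ≡ edges R + edges R
    handshake {R} sym-R irr = begin
      ∑[ i < n ] ∑[ j < n ] 𝟙 (R i j)
        ≡⟨ sum-cong-≗ (λ i → sum-cong-≗ (𝟙-halves irr i)) ⟩
      ∑[ i < n ] ∑[ j < n ] (𝟙 (below i j ∧ R i j) + 𝟙 (below j i ∧ R i j))
        ≡⟨ sum-cong-≗ (λ i → ∑-distrib-+ (λ j → 𝟙 (below i j ∧ R i j)) _) ⟩
      ∑[ i < n ] (# (λ j → below i j ∧ R i j) + ∑[ j < n ] 𝟙 (below j i ∧ R i j))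
        ≡⟨ ∑-distrib-+ (λ i → # (λ j → below i j ∧ R i j)) _ ⟩
      edges R + ∑[ i < n ] ∑[ j < n ] 𝟙 (below j i ∧ R i j)
        ≡⟨ cong (edges R +_) (∑-comm (λ i j → 𝟙 (below j i ∧ R i j))) ⟩
      edges R + ∑[ j < n ] ∑[ i < n ] 𝟙 (below j i ∧ R i j)
        ≡⟨ cong (edges R +_) (edges-cong (λ j i → sym-R i j)) ⟩
      edges R + edges R ∎
      where open ≡-Reasoning

    edges-split : ∀ (R C : Adjacency n) → edges R ≡ edges (λ i j → R i j ∧ C i j) + edges (λ i j → R i j ∧ not (C i j))
    edges-split R C = trans (sum-cong-≗ row-split) (∑-distrib-+ (λ i → # (λ j → below i j ∧ (R i j ∧ C i j))) _)
      where
      open import Data.Bool.Properties using (∧-assoc)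
      row-split : ∀ i → # (λ j → below i j ∧ R i j)
                      ≡ # (λ j → below i j ∧ (R i j ∧ C i j)) + # (λ j → below i j ∧ (R i j ∧ not (C i j)))
      row-split i = trans (#-split (λ j → below i j ∧ R i j) (C i))
                          (cong₂ _+_ (sum-cong-≗ (λ j → cong 𝟙 (∧-assoc (below i j) (R i j) (C i j))))
                                     (sum-cong-≗ (λ j → cong 𝟙 (∧-assoc (below i j) (R i j) (not (C i j))))))

    meets : Fin n → Adjacency n
    meets u i j = does (i ≟ u) ∨ does (j ≟ u)

    star : Adjacency n → Fin n → Adjacency n
    star R u i j = R i j ∧ meets u i j

    _─_ : Adjacency n → Fin n → Adjacency n
    (R ─ u) i j = R i j ∧ not (meets u i j)

    meets-symmetric : ∀ u → SymmetricAdj (meets u)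
    meets-symmetric u i j = ∨-comm (does (i ≟ u)) (does (j ≟ u))
      where open import Data.Bool.Properties using (∨-comm)

    restrict-symmetric : ∀ {R C : Adjacency n} → SymmetricAdj R → SymmetricAdj C → SymmetricAdj (λ i j → R i j ∧ C i j)
    restrict-symmetric sym-R sym-C i j = cong₂ _∧_ (sym-R i j) (sym-C i j)

    restrict-irreflexive : ∀ {R : Adjacency n} (C : Adjacency n) → IrreflexiveAdj R → IrreflexiveAdj (λ i j → R i j ∧ C i j)
    restrict-irreflexive C irr i rewrite irr i = refl

    star-symmetric : ∀ {R : Adjacency n} → SymmetricAdj R → ∀ u → SymmetricAdj (star R u)
    star-symmetric sym-R u = restrict-symmetric sym-R (meets-symmetric u)

    delete-symmetric : ∀ {R : Adjacency n} → SymmetricAdj R → ∀ u → SymmetricAdj (R ─ u)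
    delete-symmetric sym-R u = restrict-symmetric sym-R (λ i j → cong not (meets-symmetric u i j))

    star-irreflexive : ∀ {R : Adjacency n} → IrreflexiveAdj R → ∀ u → IrreflexiveAdj (star R u)
    star-irreflexive {R} irr u = restrict-irreflexive {R} (meets u) irr

    delete-irreflexive : ∀ {R : Adjacency n} → IrreflexiveAdj R → ∀ u → IrreflexiveAdj (R ─ u)
    delete-irreflexive {R} irr u = restrict-irreflexive {R} (λ i j → not (meets u i j)) irr

    #-at : ∀ (p : Fin n → Bool) u → # (λ j → p j ∧ does (j ≟ u)) ≡ 𝟙 (p u)
    #-at p u = trans (sum-cong-≗ (λ j → 𝟙-∧ (p j) (does (j ≟ u)))) (∑-pick u (𝟙 ∘ p))
      where
      𝟙-∧ : ∀ a b → 𝟙 (a ∧ b) ≡ (if b then 𝟙 a else 0)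
      𝟙-∧ false false = refl
      𝟙-∧ false true = refl
      𝟙-∧ true false = refl
      𝟙-∧ true true = refl

    degree-star : ∀ {R : Adjacency n} → SymmetricAdj R → IrreflexiveAdj R → ∀ u v →
                  degree (star R u) v ≡ (if does (v ≟ u) then degree R u else 0) + 𝟙 (R u v)
    degree-star {R} sym-R irr u v with v ≟ u
    ... | yes refl rewrite irr v = trans (sum-cong-≗ (λ j → cong 𝟙 (∧-identityʳ (R v j)))) (sym (+-identityʳ _))
      where open import Data.Bool.Properties using (∧-identityʳ)
    ... | no _ = begin
      # (λ j → R v j ∧ does (j ≟ u))                   ≡⟨ #-at (R v) u ⟩
      𝟙 (R v u)                                        ≡⟨ cong 𝟙 (sym-R v u) ⟩
      𝟙 (R u v)                                        ∎
      where open ≡-Reasoning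

    edges-star : ∀ {R : Adjacency n} → SymmetricAdj R → IrreflexiveAdj R → ∀ u → edges (star R u) ≡ degree R u
    edges-star {R} sym-R irr u = halve (begin
      edges (star R u) + edges (star R u)                         ≡⟨ handshake (star-symmetric sym-R u) (star-irreflexive {R} irr u) ⟨
      ∑[ v < n ] degree (star R u) v                              ≡⟨ sum-cong-≗ (degree-star sym-R irr u) ⟩
      ∑[ v < n ] ((if does (v ≟ u) then degree R u else 0) + 𝟙 (R u v))
                                                                  ≡⟨ ∑-distrib-+ (λ v → if does (v ≟ u) then degree R u else 0) _ ⟩
      ∑[ v < n ] (if does (v ≟ u) then degree R u else 0) + degree R u
                                                                  ≡⟨ cong (_+ degree R u) (∑-pick u (λ _ → degree R u)) ⟩
      degree R u + degree R u                                     ∎)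
      where
      open ≡-Reasoning
      halve : ∀ {a b} → a + a ≡ b + b → a ≡ b
      halve {a} {b} eq = trans (n≡⌊n+n/2⌋ a) (trans (cong ⌊_/2⌋ eq) (sym (n≡⌊n+n/2⌋ b)))

    edges-delete : ∀ {R : Adjacency n} → SymmetricAdj R → IrreflexiveAdj R → ∀ u → edges R ≡ degree R u + edges (R ─ u)
    edges-delete {R} sym-R irr u = trans (edges-split R (meets u)) (cong (_+ edges (R ─ u)) (edges-star sym-R irr u))

    degree-delete : ∀ (R : Adjacency n) {u w} → w ≢ u → degree R w ≤ degree (R ─ u) w + 1
    degree-delete R {u} {w} w≢u = subst (λ d → degree R w ≤ d + 1) without-u≡ (#-without (R w) u)
      where
      without-u≡ : # (λ j → R w j ∧ not (does (j ≟ u))) ≡ degree (R ─ u) w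
      without-u≡ = sum-cong-≗ (λ j → cong (λ b → 𝟙 (R w j ∧ not (b ∨ does (j ≟ u)))) (sym (dec-false (w ≟ u) w≢u)))

    degree≤edges : ∀ {R : Adjacency n} → SymmetricAdj R → IrreflexiveAdj R → ∀ u → degree R u ≤ edges R
    degree≤edges {R} sym-R irr u = subst (degree R u ≤_) (sym (edges-delete sym-R irr u)) (m≤m+n _ _)

    degree-sum₂ : ∀ {R : Adjacency n} → SymmetricAdj R → IrreflexiveAdj R → ∀ {u v} → v ≢ u →
                  degree R u + degree R v ≤ edges R + 1
    degree-sum₂ {R} sym-R irr {u} {v} v≢u = begin
      degree R u + degree R v                ≤⟨ +-monoʳ-≤ (degree R u) (degree-delete R v≢u) ⟩
      degree R u + (degree (R ─ u) v + 1)    ≤⟨ +-monoʳ-≤ (degree R u) (+-monoˡ-≤ 1 rest) ⟩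
      degree R u + (edges (R ─ u) + 1)       ≡⟨ +-assoc (degree R u) _ 1 ⟨
      degree R u + edges (R ─ u) + 1         ≡⟨ cong (_+ 1) (edges-delete sym-R irr u) ⟨
      edges R + 1                            ∎
      where
      open ≤-Reasoning
      rest = degree≤edges (delete-symmetric sym-R u) (delete-irreflexive {R} irr u) v

    degree-sum₃ : ∀ {R : Adjacency n} → SymmetricAdj R → IrreflexiveAdj R → ∀ {u v w} → v ≢ u → w ≢ u → w ≢ v →
                  degree R u + degree R v + degree R w ≤ edges R + 3
    degree-sum₃ {R} sym-R irr {u} {v} {w} v≢u w≢u w≢v = begin
      degree R u + degree R v + degree R w                        ≡⟨ +-assoc (degree R u) _ _ ⟩
      degree R u + (degree R v + degree R w)                      ≤⟨ +-monoʳ-≤ (degree R u) deleting-u ⟩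
      degree R u + ((degree R′ v + 1) + (degree R′ w + 1))        ≡⟨ cong (degree R u +_) (shuffle (degree R′ v) (degree R′ w)) ⟩
      degree R u + ((degree R′ v + degree R′ w) + 2)              ≤⟨ +-monoʳ-≤ (degree R u) (+-monoˡ-≤ 2 rest) ⟩
      degree R u + ((edges R′ + 1) + 2)                           ≡⟨ cong (degree R u +_) (+-assoc (edges R′) 1 2) ⟩
      degree R u + (edges R′ + 3)                                 ≡⟨ +-assoc (degree R u) _ 3 ⟨
      degree R u + edges R′ + 3                                   ≡⟨ cong (_+ 3) (edges-delete sym-R irr u) ⟨
      edges R + 3                                                 ∎
      where
      open ≤-Reasoning
      R′ = R ─ u
      deleting-u = +-mono-≤ (degree-delete R v≢u) (degree-delete R w≢u)
      rest = degree-sum₂ (delete-symmetric sym-R u) (delete-irreflexive {R} irr u) w≢v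
      shuffle : ∀ a b → (a + 1) + (b + 1) ≡ (a + b) + 2
      shuffle a b = solve 2 (λ a b → (a :+ con 1) :+ (b :+ con 1) := (a :+ b) :+ con 2) refl a b

module Pairings where

  open import Data.Nat using (ℕ; zero; suc; _*_)
  open import Data.Nat.Properties using (+-0-commutativeMonoid)
  open import Data.Fin as Fin using (Fin; zero; suc; _≟_)
  open import Data.Fin.Properties using (suc-injective)
  open import Data.Fin.Permutation using (Permutation′; permutation; transpose; _⟨$⟩ʳ_; _⟨$⟩ˡ_; inverseˡ; inverseʳ)
  import Data.Fin.Permutation.Components as Components
  open import Data.Empty using (⊥-elim)
  open import Function using (_∘_)
  open import Relation.Nullary using (does; yes; no)
  open import Relation.Nullary.Decidable using (dec-true; dec-false)
  open import Relation.Binary.PropositionalEquality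
  open import Algebra.Properties.CommutativeMonoid.Sum +-0-commutativeMonoid using (sum; ∑-permute)
  open import Defs using (Graph; deg)
  open Counting

  -- A pairing of Fin n: a fixed-point-free involution, i.e. a perfect matching of the complete graph.
  record Pairing (n : ℕ) : Set where
    field
      partner       : Fin n → Fin n
      involutive    : ∀ v → partner (partner v) ≡ v
      fixpoint-free : ∀ v → partner v ≢ v
  open Pairing public

  standard-pairing : ∀ q → Pairing (q * 2)
  standard-pairing zero = record { partner = λ () ; involutive = λ () ; fixpoint-free = λ () }
  standard-pairing (suc q) = record { partner = p ; involutive = p-involutive ; fixpoint-free = p-fixpoint-free }
    where
    P = standard-pairing q
    p : Fin (suc q * 2) → Fin (suc q * 2)
    p zero = suc zero
    p (suc zero) = zero
    p (suc (suc i)) = suc (suc (partner P i))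
    p-involutive : ∀ v → p (p v) ≡ v
    p-involutive zero = refl
    p-involutive (suc zero) = refl
    p-involutive (suc (suc i)) = cong (λ (j : Fin (q * 2)) → Fin.suc (Fin.suc j)) (involutive P i)
    p-fixpoint-free : ∀ v → p v ≢ v
    p-fixpoint-free zero ()
    p-fixpoint-free (suc zero) ()
    p-fixpoint-free (suc (suc i)) eq = fixpoint-free P i (suc-injective (suc-injective eq))

  module _ {n : ℕ} (P : Pairing n) where

    partner-injective : ∀ {u v} → partner P u ≡ partner P v → u ≡ v
    partner-injective {u} {v} eq = trans (sym (involutive P u)) (trans (cong (partner P) eq) (involutive P v))

    partner-swap : ∀ {u v} → partner P u ≡ v → u ≡ partner P v
    partner-swap {u} pu≡v = trans (sym (involutive P u)) (cong (partner P) pu≡v)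

    ∑-partner : ∀ (f : Fin n → ℕ) → sum (f ∘ partner P) ≡ sum f
    ∑-partner f = sym (∑-permute f (permutation (partner P) (partner P) (involutive P) (involutive P)))

    pairs : Graph n
    pairs = record
      { adj = λ i j → does (j ≟ partner P i)
      ; sym = pairs-sym
      ; irrefl = λ i → dec-false (i ≟ partner P i) (fixpoint-free P i ∘ sym)
      }
      where
      pairs-sym : ∀ i j → does (j ≟ partner P i) ≡ does (i ≟ partner P j)
      pairs-sym i j with j ≟ partner P i | i ≟ partner P j
      ... | yes _ | yes _ = refl
      ... | no _ | no _ = refl
      ... | yes refl | no i≢pj = ⊥-elim (i≢pj (sym (involutive P i)))
      ... | no j≢pi | yes refl = ⊥-elim (j≢pi (sym (involutive P j)))

    pairs-degree : ∀ v → deg pairs v ≡ 1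
    pairs-degree v = trans (count≡# (λ j → does (j ≟ partner P v))) (#-single (partner P v))

  conjugate : ∀ {n} → Permutation′ n → Pairing n → Pairing n
  conjugate {n} π P = record { partner = p′ ; involutive = p′-involutive ; fixpoint-free = p′-fixpoint-free }
    where
    p′ : Fin n → Fin n
    p′ v = π ⟨$⟩ʳ partner P (π ⟨$⟩ˡ v)
    p′-involutive : ∀ v → p′ (p′ v) ≡ v
    p′-involutive v = begin
      π ⟨$⟩ʳ partner P (π ⟨$⟩ˡ (π ⟨$⟩ʳ partner P (π ⟨$⟩ˡ v)))  ≡⟨ cong (λ w → π ⟨$⟩ʳ partner P w) (inverseˡ π) ⟩
      π ⟨$⟩ʳ partner P (partner P (π ⟨$⟩ˡ v))                  ≡⟨ cong (π ⟨$⟩ʳ_) (involutive P _) ⟩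
      π ⟨$⟩ʳ (π ⟨$⟩ˡ v)                                        ≡⟨ inverseʳ π ⟩
      v                                                        ∎
      where open ≡-Reasoning
    p′-fixpoint-free : ∀ v → p′ v ≢ v
    p′-fixpoint-free v eq = fixpoint-free P (π ⟨$⟩ˡ v) (trans (sym (inverseˡ π)) (cong (π ⟨$⟩ˡ_) eq))

  module _ {n : ℕ} (i j : Fin n) where

    transpose-left : Components.transpose i j i ≡ j
    transpose-left rewrite dec-true (i ≟ i) refl = refl

    transpose-right : Components.transpose i j j ≡ i
    transpose-right with j ≟ i
    ... | yes j≡i = j≡i
    ... | no _ rewrite dec-true (j ≟ j) refl = refl

    transpose-other : ∀ {k} → k ≢ i → k ≢ j → Components.transpose i j k ≡ k
    transpose-other {k} k≢i k≢j rewrite dec-false (k ≟ i) k≢i | dec-false (k ≟ j) k≢j = refl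

  -- Rematching: pair a with x and the old partners b, y of a, x with each other (for x ∉ {a, b}).
  -- This is P conjugated by the transposition of x and b.
  module Rematch {n : ℕ} (P : Pairing n) {a x : Fin n} (x≢a : x ≢ a) (x≢b : x ≢ partner P a) where

    private
      p = partner P
      b = p a
      y = p x
      a≢b : a ≢ b
      a≢b = fixpoint-free P a ∘ sym
      y≢x : y ≢ x
      y≢x = fixpoint-free P x
      y≢b : y ≢ b
      y≢b y≡b = x≢a (partner-injective P y≡b)
      σ = transpose x b

    rematched : Pairing n
    rematched = conjugate σ P

    at-a : partner rematched a ≡ x
    at-a = begin
      σ ⟨$⟩ʳ p (σ ⟨$⟩ˡ a)  ≡⟨ cong (λ v → σ ⟨$⟩ʳ p v) (transpose-other b x a≢b (x≢a ∘ sym)) ⟩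
      σ ⟨$⟩ʳ b             ≡⟨ transpose-right x b ⟩
      x                    ∎
      where open ≡-Reasoning

    at-x : partner rematched x ≡ a
    at-x = begin
      σ ⟨$⟩ʳ p (σ ⟨$⟩ˡ x)  ≡⟨ cong (λ v → σ ⟨$⟩ʳ p v) (transpose-right b x) ⟩
      σ ⟨$⟩ʳ p b           ≡⟨ cong (σ ⟨$⟩ʳ_) (involutive P a) ⟩
      σ ⟨$⟩ʳ a             ≡⟨ transpose-other x b (x≢a ∘ sym) a≢b ⟩
      a                    ∎
      where open ≡-Reasoning

    at-y : partner rematched y ≡ b
    at-y = begin
      σ ⟨$⟩ʳ p (σ ⟨$⟩ˡ y)  ≡⟨ cong (λ v → σ ⟨$⟩ʳ p v) (transpose-other b x y≢b y≢x) ⟩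
      σ ⟨$⟩ʳ p y           ≡⟨ cong (σ ⟨$⟩ʳ_) (involutive P x) ⟩
      σ ⟨$⟩ʳ x             ≡⟨ transpose-left x b ⟩
      b                    ∎
      where open ≡-Reasoning

    elsewhere : ∀ {v} → v ≢ a → v ≢ x → v ≢ b → v ≢ y → partner rematched v ≡ p v
    elsewhere {v} v≢a v≢x v≢b v≢y = begin
      σ ⟨$⟩ʳ p (σ ⟨$⟩ˡ v)  ≡⟨ cong (λ w → σ ⟨$⟩ʳ p w) (transpose-other b x v≢b v≢x) ⟩
      σ ⟨$⟩ʳ p v           ≡⟨ transpose-other x b (v≢y ∘ partner-swap P) (v≢a ∘ partner-injective P) ⟩
      p v                  ∎
      where open ≡-Reasoning

module Matchings where

  open import Data.Nat using (ℕ; suc; _+_; _*_; _<_; z≤n; s≤s)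
  open import Data.Nat.Properties hiding (_≟_)
  open import Data.Bool using (true; false; _∧_; not; T)
  open import Data.Fin using (Fin; _≟_)
  open import Data.Product using (_,_)
  open import Data.Empty using (⊥; ⊥-elim)
  open import Data.Unit using (tt)
  open import Relation.Nullary using (does; yes; no; ¬_)
  open import Relation.Nullary.Decidable using (dec-true)
  open import Relation.Binary.PropositionalEquality
  open import Algebra.Properties.CommutativeMonoid.Sum +-0-commutativeMonoid
    using (sum-syntax; sum-cong-≗; ∑-distrib-+)
  open import Defs hiding (sym)
  open Counting
  open EdgeCounting
  open Pairings

  _∖_ : ∀ {n} → Adjacency n → Adjacency n → Adjacency n
  (R ∖ S) i j = R i j ∧ not (S i j)

  module _ {n : ℕ} where

    deg≡degree : ∀ (G : Graph n) v → deg G v ≡ degree (adj G) v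
    deg≡degree G v = count≡# (adj G v)

    deletedEdges≡edges : ∀ (G H : Graph n) → deletedEdges G H ≡ edges (adj G ∖ adj H)
    deletedEdges≡edges G H = trans (listSum≡∑ row) (sum-cong-≗ (λ i → count≡# (λ j → below i j ∧ (adj G ∖ adj H) i j)))
      where
      row : Fin n → ℕ
      row i = count (λ j → below i j ∧ (adj G ∖ adj H) i j)

    ∖-symmetric : ∀ (G H : Graph n) → SymmetricAdj (adj G ∖ adj H)
    ∖-symmetric G H i j = cong₂ (λ a b → a ∧ not b) (Defs.sym G i j) (Defs.sym H i j)

    ∖-irreflexive : ∀ (G H : Graph n) → IrreflexiveAdj (adj G ∖ adj H)
    ∖-irreflexive G H i rewrite irrefl G i = refl

    deg-split : ∀ {G H : Graph n} → H ⊆ᴳ G → ∀ v → deg G v ≡ deg H v + degree (adj G ∖ adj H) v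
    deg-split {G} {H} H⊆G v = begin
      deg G v                                                ≡⟨ deg≡degree G v ⟩
      # (adj G v)                                            ≡⟨ #-split (adj G v) (adj H v) ⟩
      # (λ j → adj G v j ∧ adj H v j) + degree deleted v     ≡⟨ cong (_+ degree deleted v) in-H ⟩
      # (adj H v) + degree deleted v                         ≡⟨ cong (_+ degree deleted v) (deg≡degree H v) ⟨
      deg H v + degree deleted v                             ∎
      where
      open ≡-Reasoning
      deleted = adj G ∖ adj H
      ∧-sub : ∀ {a b} → (T b → T a) → a ∧ b ≡ b
      ∧-sub {true} _ = refl
      ∧-sub {false} {false} _ = refl
      ∧-sub {false} {true} b⇒a = ⊥-elim (b⇒a tt)
      in-H : # (λ j → adj G v j ∧ adj H v j) ≡ # (adj H v)
      in-H = sum-cong-≗ (λ j → cong 𝟙 (∧-sub (H⊆G v j)))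

    isolate : Graph n → Fin n → Graph n
    isolate G v = record
      { adj = adj G ─ v
      ; sym = delete-symmetric (Defs.sym G) v
      ; irrefl = delete-irreflexive {R = adj G} (irrefl G) v
      }

    isolate-⊆ : ∀ G v → isolate G v ⊆ᴳ G
    isolate-⊆ G v i j = ∧-left (adj G i j)
      where
      ∧-left : ∀ a {b} → T (a ∧ b) → T a
      ∧-left true _ = tt

    isolate-isolated : ∀ G v j → adj (isolate G v) v j ≡ false
    isolate-isolated G v j rewrite dec-true (v ≟ v) refl = ∧-identity (adj G v j)
      where
      ∧-identity : ∀ a → a ∧ false ≡ false
      ∧-identity true = refl
      ∧-identity false = refl

    -- Isolating v costs exactly deg(v) deleted edges: the deleted edges form the star at v.
    isolate-cost : ∀ G v → deletedEdges G (isolate G v) ≡ deg G v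
    isolate-cost G v = begin
      deletedEdges G (isolate G v)     ≡⟨ deletedEdges≡edges G (isolate G v) ⟩
      edges (adj G ∖ (adj G ─ v))      ≡⟨ edges-cong (λ i j → deleted-star (adj G i j) (meets v i j)) ⟩
      edges (star (adj G) v)           ≡⟨ edges-star (Defs.sym G) (irrefl G) v ⟩
      degree (adj G) v                 ≡⟨ deg≡degree G v ⟨
      deg G v                          ∎
      where
      open ≡-Reasoning
      deleted-star : ∀ a c → a ∧ not (a ∧ not c) ≡ a ∧ c
      deleted-star false c = refl
      deleted-star true false = refl
      deleted-star true true = refl

    isolated⇒no-PM : ∀ (H : Graph n) v → (∀ j → adj H v j ≡ false) → ∀ M → ¬ IsPerfectMatching H M
    isolated⇒no-PM H v isolated M (M⊆H , deg≡1) with #>0⇒witness (adj M v) M-edge-at-v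
      where
      M-edge-at-v : 0 < # (adj M v)
      M-edge-at-v = subst (0 <_) (trans (sym (deg≡1 v)) (deg≡degree M v)) (s≤s z≤n)
    ... | j , Mvj = not-H-edge (M⊆H v j (subst T (sym Mvj) tt))
      where
      not-H-edge : T (adj H v j) → ⊥
      not-H-edge t = subst T (isolated j) t

    -- If Fin n can be paired up, no graph on Fin n has an almost-perfect matching: its edges would
    -- cover all vertices but one, making n odd.
    paired⇒no-APM : Pairing n → ∀ H M → ¬ IsAlmostPerfectMatching H M
    paired⇒no-APM P H M (_ , u , deg-u≡0 , deg≡1) = even≢odd (edges (adj (pairs P))) (edges (adj M)) (trans (sym n-even) n-odd)
      where
      open ≡-Reasoning
      n-even : n ≡ 2 * edges (adj (pairs P))
      n-even = begin
        n                                   ≡⟨ #-true n ⟨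
        ∑[ v < n ] 1                        ≡⟨ sum-cong-≗ (λ v → trans (sym (pairs-degree P v)) (deg≡degree (pairs P) v)) ⟩
        ∑[ v < n ] degree (adj (pairs P)) v ≡⟨ handshake (Defs.sym (pairs P)) (irrefl (pairs P)) ⟩
        edges (adj (pairs P)) + edges (adj (pairs P)) ≡⟨ cong (edges (adj (pairs P)) +_) (+-identityʳ _) ⟨
        2 * edges (adj (pairs P))           ∎
      covered : ∀ v → 1 ≡ 𝟙 (does (v ≟ u)) + degree (adj M) v
      covered v with v ≟ u
      ... | yes refl = cong suc (trans (sym deg-u≡0) (deg≡degree M u))
      ... | no v≢u = trans (sym (deg≡1 v v≢u)) (deg≡degree M v)
      n-odd : n ≡ suc (2 * edges (adj M))
      n-odd = begin
        n                                                  ≡⟨ #-true n ⟨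
        ∑[ v < n ] 1                                       ≡⟨ sum-cong-≗ covered ⟩
        ∑[ v < n ] (𝟙 (does (v ≟ u)) + degree (adj M) v)   ≡⟨ ∑-distrib-+ (λ v → 𝟙 (does (v ≟ u))) (degree (adj M)) ⟩
        # (λ v → does (v ≟ u)) + ∑[ v < n ] degree (adj M) v ≡⟨ cong₂ _+_ (#-single u) (handshake (Defs.sym M) (irrefl M)) ⟩
        suc (edges (adj M) + edges (adj M))                ≡⟨ cong (λ e → suc (edges (adj M) + e)) (+-identityʳ _) ⟨
        suc (2 * edges (adj M))                            ∎

    pairing⇒perfect-matching : ∀ (H : Graph n) (P : Pairing n) → (∀ v → adj H v (partner P v) ≡ true) →
                               IsPerfectMatching H (pairs P)
    pairing⇒perfect-matching H P pairs-in-H = pairs-⊆ , pairs-degree P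
      where
      pairs-⊆ : pairs P ⊆ᴳ H
      pairs-⊆ i j t with j ≟ partner P i
      ... | yes refl = subst T (sym (pairs-in-H i)) tt

module DegreeArithmetic where

  open import Data.Nat using (zero; suc; _+_; _*_; _≤_; _<_; z≤n; s≤s)
  open import Data.Nat.Properties
  open import Data.Empty using (⊥; ⊥-elim)
  open import Relation.Binary.PropositionalEquality
  open import Data.Nat.Solver using (module +-*-Solver)
  open +-*-Solver using (solve; _:+_; _:*_; _:=_; con)

  -- Throughout, a vertex has degree d in the
  -- subgraph and x deleted edges at it, with δ ≤ d + x; e < δ edges are deleted in all;
  -- a vertex is poor when 2d ≤ n; and the density hypothesis is 3n + 6 ≤ 4δ.

  keeps-an-edge : ∀ {δ d x} → δ ≤ d + x → x < δ → 0 < d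
  keeps-an-edge {d = zero} δ≤x x<δ = ⊥-elim (<-irrefl refl (<-≤-trans x<δ δ≤x))
  keeps-an-edge {d = suc d} _ _ = s≤s z≤n

  rich-pair : ∀ {n a b} → n < 2 * a → n < 2 * b → n < a + b
  rich-pair {n} {a} {b} n<2a n<2b = *-cancelˡ-≤ 2 (begin
    2 * suc n          ≡⟨ solve 1 (λ n → con 2 :* (con 1 :+ n) := (con 1 :+ n) :+ (con 1 :+ n)) refl n ⟩
    suc n + suc n      ≤⟨ +-mono-≤ n<2a n<2b ⟩
    2 * a + 2 * b      ≡⟨ *-distribˡ-+ 2 a b ⟨
    2 * (a + b)        ∎)
    where open ≤-Reasoning

  -- A vertex a other than a poor vertex b (the two sharing at most one deleted edge) keeps two edges.
  two-edges : ∀ {n δ e da xa db xb} → 3 * n + 6 ≤ 4 * δ → e < δ →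
              δ ≤ da + xa → δ ≤ db + xb → 2 * db ≤ n → xa + xb ≤ e + 1 → 2 ≤ da
  two-edges {n} {δ} {e} {da} {xa} {db} {xb} dense e<δ δ≤a δ≤b poor-b shared =
    *-cancelˡ-< 4 1 da (+-cancelˡ-≤ (2 * n) 5 (4 * da) (begin
      2 * n + 5                   ≤⟨ m≤m+n (2 * n + 5) (n + 1) ⟩
      2 * n + 5 + (n + 1)         ≡⟨ solve 1 (λ n → con 2 :* n :+ con 5 :+ (n :+ con 1) := con 3 :* n :+ con 6) refl n ⟩
      3 * n + 6                   ≤⟨ dense ⟩
      4 * δ                       ≤⟨ *-monoʳ-≤ 4 δ≤da+db ⟩
      4 * (da + db)               ≡⟨ solve 2 (λ a b → con 4 :* (a :+ b) := con 4 :* a :+ con 2 :* (con 2 :* b)) refl da db ⟩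
      4 * da + 2 * (2 * db)       ≤⟨ +-monoʳ-≤ (4 * da) (*-monoʳ-≤ 2 poor-b) ⟩
      4 * da + 2 * n              ≡⟨ +-comm (4 * da) (2 * n) ⟩
      2 * n + 4 * da              ∎))
    where
    open ≤-Reasoning
    δ≤da+db : δ ≤ da + db
    δ≤da+db = +-cancelʳ-≤ δ δ (da + db) (begin
      δ + δ                  ≤⟨ +-mono-≤ δ≤a δ≤b ⟩
      (da + xa) + (db + xb)  ≡⟨ solve 4 (λ a x b y → (a :+ x) :+ (b :+ y) := (a :+ b) :+ (x :+ y)) refl da xa db xb ⟩
      (da + db) + (xa + xb)  ≤⟨ +-monoʳ-≤ (da + db) shared ⟩
      (da + db) + (e + 1)    ≡⟨ cong (da + db +_) (+-comm e 1) ⟩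
      (da + db) + suc e      ≤⟨ +-monoʳ-≤ (da + db) e<δ ⟩
      (da + db) + δ          ∎)

  -- There are no three poor vertices (sharing at most three deleted edges).
  no-three-poor : ∀ {n δ e d₁ x₁ d₂ x₂ d₃ x₃} → 3 * n + 6 ≤ 4 * δ → e < δ →
                  δ ≤ d₁ + x₁ → δ ≤ d₂ + x₂ → δ ≤ d₃ + x₃ → 2 * d₁ ≤ n → 2 * d₂ ≤ n → 2 * d₃ ≤ n →
                  x₁ + x₂ + x₃ ≤ e + 3 → ⊥
  no-three-poor {n} {δ} {e} {d₁} {x₁} {d₂} {x₂} {d₃} {x₃} dense e<δ δ≤1 δ≤2 δ≤3 poor₁ poor₂ poor₃ shared =
    <-irrefl refl (≤-<-trans dense four-δ)
    where
    open ≤-Reasoning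
    D = d₁ + d₂ + d₃
    two-δ : δ + δ ≤ D + 2
    two-δ = +-cancelʳ-≤ δ (δ + δ) (D + 2) (begin
      δ + δ + δ                            ≤⟨ +-mono-≤ (+-mono-≤ δ≤1 δ≤2) δ≤3 ⟩
      (d₁ + x₁) + (d₂ + x₂) + (d₃ + x₃)
        ≡⟨ solve 6 (λ a x b y c z → (a :+ x) :+ (b :+ y) :+ (c :+ z) := (a :+ b :+ c) :+ (x :+ y :+ z)) refl d₁ x₁ d₂ x₂ d₃ x₃ ⟩
      D + (x₁ + x₂ + x₃)                   ≤⟨ +-monoʳ-≤ D shared ⟩
      D + (e + 3)                          ≡⟨ solve 2 (λ d e → d :+ (e :+ con 3) := d :+ con 2 :+ (con 1 :+ e)) refl D e ⟩
      D + 2 + suc e                        ≤⟨ +-monoʳ-≤ (D + 2) e<δ ⟩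
      D + 2 + δ                            ∎)
    four-δ : 4 * δ < 3 * n + 6
    four-δ = begin-strict
      4 * δ                        ≡⟨ solve 1 (λ d → con 4 :* d := con 2 :* (d :+ d)) refl δ ⟩
      2 * (δ + δ)                  ≤⟨ *-monoʳ-≤ 2 two-δ ⟩
      2 * (D + 2)
        ≡⟨ solve 3 (λ a b c → con 2 :* (a :+ b :+ c :+ con 2) := con 2 :* a :+ con 2 :* b :+ con 2 :* c :+ con 4) refl d₁ d₂ d₃ ⟩
      2 * d₁ + 2 * d₂ + 2 * d₃ + 4 ≤⟨ +-monoˡ-≤ 4 (+-mono-≤ (+-mono-≤ poor₁ poor₂) poor₃) ⟩
      n + n + n + 4                <⟨ +-monoʳ-< (n + n + n) (s≤s (s≤s (s≤s (s≤s (s≤s z≤n))))) ⟩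
      n + n + n + 6                ≡⟨ solve 1 (λ n → n :+ n :+ n :+ con 6 := con 3 :* n :+ con 6) refl n ⟩
      3 * n + 6                    ∎

module RobustMatching where

  open import Data.Nat using (ℕ; zero; suc; _+_; _*_; _≤_; _<_; _≤?_; z≤n; s≤s)
  open import Data.Nat.Properties hiding (_≟_)
  open import Data.Nat.Induction using (<-rec)
  open import Data.Bool using (Bool; true; false; _∧_; not)
  open import Data.Bool.Properties using (¬-not; not-injective) renaming (_≟_ to _≟ᵇ_)
  open import Data.Fin using (Fin; _≟_)
  open import Data.Fin.Properties using (any?)
  open import Data.Product using (Σ; ∃; _×_; _,_; proj₁; proj₂)
  open import Data.Sum using (_⊎_; inj₁; inj₂)
  open import Data.Empty using (⊥; ⊥-elim)
  open import Data.Unit using (⊤; tt)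
  open import Function using (_∘_)
  open import Relation.Nullary using (Dec; does; yes; no; _×-dec_; ¬?)
  open import Relation.Binary.PropositionalEquality
  open import Defs hiding (sym)
  open Counting
  open EdgeCounting
  open Pairings
  open Matchings
  open DegreeArithmetic
  open Booleans

  descend : ∀ {A : Set} (Φ : A → ℕ) (I : A → Set) →
            (∀ s → I s → 0 < Φ s → ∃ λ s′ → I s′ × Φ s′ < Φ s) →
            ∀ s → I s → ∃ λ s → I s × Φ s ≡ 0
  descend Φ I improve s I-s = <-rec Reaches-zero step (Φ s) s I-s refl
    where
    Reaches-zero : ℕ → Set
    Reaches-zero k = ∀ s → I s → Φ s ≡ k → ∃ λ s → I s × Φ s ≡ 0
    step : ∀ k → (∀ {j} → j < k → Reaches-zero j) → Reaches-zero k
    step zero _ s I-s Φs≡0 = s , I-s , Φs≡0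
    step (suc k) smaller s I-s Φs≡k with improve s I-s (subst (0 <_) (sym Φs≡k) (s≤s z≤n))
    ... | s′ , I-s′ , Φs′<Φs = smaller (subst (Φ s′ <_) Φs≡k Φs′<Φs) s′ I-s′ refl

  module Robust {n : ℕ} (P₀ : Pairing n) {G H : Graph n} (H⊆G : H ⊆ᴳ G) {δ : ℕ}
                (min-deg : ∀ v → δ ≤ deg G v) (dense : 3 * n + 6 ≤ 4 * δ) (few : deletedEdges G H < δ) where

    h : Adjacency n
    h = adj H

    D : Adjacency n
    D = adj G ∖ adj H

    D-sym : SymmetricAdj D
    D-sym = ∖-symmetric G H

    D-irr : IrreflexiveAdj D
    D-irr = ∖-irreflexive G H

    δ≤split : ∀ v → δ ≤ deg H v + degree D v
    δ≤split v = subst (δ ≤_) (deg-split {G = G} {H = H} H⊆G v) (min-deg v)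

    edges-D<δ : edges D < δ
    edges-D<δ = subst (_< δ) (deletedEdges≡edges G H) few

    h-edge⇒≢ : ∀ {u v} → h u v ≡ true → v ≢ u
    h-edge⇒≢ {u} huv refl = true≢false (trans (sym huv) (irrefl H u))

    neighbour : ∀ u → ∃ λ v → h u v ≡ true
    neighbour u = #>0⇒witness (h u) (subst (0 <_) (deg≡degree H u)
                    (keeps-an-edge {d = deg H u} {x = degree D u} (δ≤split u) (≤-<-trans (degree≤edges D-sym D-irr u) edges-D<δ)))

    poor : Fin n → Bool
    poor v = does (2 * deg H v ≤? n)

    poor⇒ : ∀ {v} → poor v ≡ true → 2 * deg H v ≤ n
    poor⇒ {v} = does-true (2 * deg H v ≤? n)

    rich⇒ : ∀ {v} → poor v ≡ false → n < 2 * deg H v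
    rich⇒ {v} = ≰⇒> ∘ does-false (2 * deg H v ≤? n)

    no-three-poor-vertices : ∀ {u v w} → poor u ≡ true → poor v ≡ true → poor w ≡ true → v ≢ u → w ≢ u → w ≢ v → ⊥
    no-three-poor-vertices {u} {v} {w} pu pv pw v≢u w≢u w≢v =
      no-three-poor {d₁ = deg H u} {degree D u} {deg H v} {degree D v} {deg H w} {degree D w}
        dense edges-D<δ (δ≤split u) (δ≤split v) (δ≤split w) (poor⇒ pu) (poor⇒ pv) (poor⇒ pw)
        (degree-sum₃ D-sym D-irr v≢u w≢u w≢v)

    two-neighbours : ∀ {a b} → poor b ≡ true → b ≢ a → 2 ≤ deg H a
    two-neighbours {a} {b} pb b≢a =
      two-edges {da = deg H a} {degree D a} {deg H b} {degree D b}
        dense edges-D<δ (δ≤split a) (δ≤split b) (poor⇒ pb) (degree-sum₂ D-sym D-irr b≢a)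

    PoorWithin : Fin n → Fin n → Set
    PoorWithin a a′ = ∀ w → poor w ≡ true → w ≡ a ⊎ w ≡ a′

    poor-companion : ∀ a → poor a ≡ true → ∃ λ a′ → PoorWithin a a′ × (a′ ≡ a ⊎ 2 ≤ deg H a)
    poor-companion a pa with any? (λ v → (poor v ≟ᵇ true) ×-dec ¬? (v ≟ a))
    ... | yes (a′ , pa′ , a′≢a) = a′ , within , inj₂ (two-neighbours pa′ a′≢a)
      where
      within : PoorWithin a a′
      within w pw with w ≟ a | w ≟ a′
      ... | yes w≡a | _ = inj₁ w≡a
      ... | no _ | yes w≡a′ = inj₂ w≡a′
      ... | no w≢a | no w≢a′ = ⊥-elim (no-three-poor-vertices pa pa′ pw a′≢a w≢a w≢a′)
    ... | no none = a , within , inj₁ refl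
      where
      within : PoorWithin a a
      within w pw with w ≟ a
      ... | yes w≡a = inj₁ w≡a
      ... | no w≢a = ⊥-elim (none (w , pw , w≢a))

    good : Pairing n → Fin n → Bool
    good P v = h v (partner P v)

    defect : (Fin n → Bool) → Pairing n → ℕ
    defect w P = # (λ v → w v ∧ not (good P v))

    defect-zero : ∀ w P → defect w P ≡ 0 → ∀ v → w v ≡ true → good P v ≡ true
    defect-zero w P zero-defect v wv with #≡0⇒false (λ v → w v ∧ not (good P v)) zero-defect v
    ... | not-bad rewrite wv = not-injective not-bad

    defect-positive : ∀ w P → 0 < defect w P → ∃ λ v → w v ≡ true × good P v ≡ false
    defect-positive w P pos with #>0⇒witness (λ v → w v ∧ not (good P v)) pos
    ... | v , bad-v = let (wv , not-good) = ∧-true bad-v in v , wv , not-injective not-good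

    not-partner : ∀ P {a x} → good P a ≡ false → h a x ≡ true → x ≢ partner P a
    not-partner P {a} bad-a hax x≡b = true≢false (trans (sym hax) (trans (cong (h a) x≡b) bad-a))

    module Improve (P : Pairing n) {a x : Fin n} (hax : h a x ≡ true) (bad-a : good P a ≡ false) where

      private
        b = partner P a
        y = partner P x
        open Rematch P (h-edge⇒≢ hax) (not-partner P bad-a hax) using (at-a; at-x; at-y; elsewhere)

      open Rematch P (h-edge⇒≢ hax) (not-partner P bad-a hax) public using (rematched)

      a-good : good rematched a ≡ true
      a-good = trans (cong (h a) at-a) hax

      y-good : h b y ≡ true → good rematched y ≡ true
      y-good hby = trans (cong (h y) at-y) (trans (Defs.sym H y b) hby)

      keeps-good : ∀ v → v ≢ y → good P v ≡ true → good rematched v ≡ true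
      keeps-good v v≢y good-v = by-cases (v ≟ a) (v ≟ x) (v ≟ b)
        where
        Good′ : Fin n → Set
        Good′ u = good rematched u ≡ true
        b-bad : good P b ≡ false
        b-bad = trans (cong (h b) (involutive P a)) (trans (Defs.sym H b a) bad-a)
        by-cases : Dec (v ≡ a) → Dec (v ≡ x) → Dec (v ≡ b) → Good′ v
        by-cases (yes v≡a) _ _ = subst Good′ (sym v≡a) a-good
        by-cases (no _) (yes v≡x) _ = subst Good′ (sym v≡x) (trans (cong (h x) at-x) (trans (Defs.sym H x a) hax))
        by-cases (no _) (no _) (yes v≡b) =
          ⊥-elim (true≢false (trans (sym good-v) (subst (λ u → good P u ≡ false) (sym v≡b) b-bad)))
        by-cases (no v≢a) (no v≢x) (no v≢b) = trans (cong (h v) (elsewhere v≢a v≢x v≢b v≢y)) good-v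

      improves : ∀ w → w a ≡ true → w y ≡ false ⊎ h b y ≡ true → defect w rematched < defect w P
      improves w wa y-ok = ∑-mono-< a no-worse at-a-better
        where
        𝟙-defect-mono : ∀ s {c c′} → (c ≡ true → c′ ≡ true) → 𝟙 (s ∧ not c′) ≤ 𝟙 (s ∧ not c)
        𝟙-defect-mono false _ = z≤n
        𝟙-defect-mono true {true} c⇒c′ rewrite c⇒c′ refl = z≤n
        𝟙-defect-mono true {false} {c′} _ with c′
        ... | true = z≤n
        ... | false = ≤-refl
        no-worse : ∀ v → 𝟙 (w v ∧ not (good rematched v)) ≤ 𝟙 (w v ∧ not (good P v))
        no-worse v with v ≟ y
        ... | no v≢y = 𝟙-defect-mono (w v) (keeps-good v v≢y)
        ... | yes refl = at-y-no-worse y-ok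
          where
          at-y-no-worse : w y ≡ false ⊎ h b y ≡ true → 𝟙 (w y ∧ not (good rematched y)) ≤ 𝟙 (w y ∧ not (good P y))
          at-y-no-worse (inj₁ wy≡false) rewrite wy≡false = z≤n
          at-y-no-worse (inj₂ hby) = 𝟙-defect-mono (w y) (λ _ → y-good hby)
        at-a-better : 𝟙 (w a ∧ not (good rematched a)) < 𝟙 (w a ∧ not (good P a))
        at-a-better rewrite a-good | bad-a | wa = s≤s z≤n

    avoiding-neighbour : ∀ P {a a′} → good P a ≡ false → a′ ≡ a ⊎ 2 ≤ deg H a →
                         ∃ λ x → h a x ≡ true × x ≢ partner P a′
    avoiding-neighbour P {a} bad-a (inj₁ refl) = let (x , hax) = neighbour a in x , hax , not-partner P bad-a hax
    avoiding-neighbour P {a} {a′} bad-a (inj₂ two≤deg) with #>0⇒witness avoids-pa′ one≤#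
      where
      avoids-pa′ = λ x → h a x ∧ not (does (x ≟ partner P a′))
      one≤# : 0 < # avoids-pa′
      one≤# = +-cancelʳ-≤ 1 1 (# avoids-pa′)
                (≤-trans (subst (2 ≤_) (deg≡degree H a) two≤deg) (#-without (h a) (partner P a′)))
    ... | x , hax∧x≢pa′ = let (hax , x≢pa′) = ∧-true hax∧x≢pa′ in
                          x , hax , does-false (x ≟ partner P a′) (not-injective x≢pa′)

    -- Phase 1 step: a badly paired poor vertex a has an H-neighbour x whose partner is rich, because
    -- the poor vertices lie in {a, a′} and x avoids the partners of both.
    rich-partner-neighbour : ∀ P a → poor a ≡ true → good P a ≡ false → ∃ λ x → h a x ≡ true × poor (partner P x) ≡ false
    rich-partner-neighbour P a pa bad-a with poor-companion a pa
    ... | a′ , within , companion with avoiding-neighbour P bad-a companion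
    ...   | x , hax , x≢pa′ = x , hax , ¬-not y-not-poor
      where
      y-not-poor : poor (partner P x) ≢ true
      y-not-poor py with within (partner P x) py
      ... | inj₁ y≡a = not-partner P bad-a hax (partner-swap P y≡a)
      ... | inj₂ y≡a′ = x≢pa′ (partner-swap P y≡a′)

    phase₁-step : ∀ P → ⊤ → 0 < defect poor P → ∃ λ P′ → ⊤ × defect poor P′ < defect poor P
    phase₁-step P _ pos with defect-positive poor P pos
    ... | a , pa , bad-a with rich-partner-neighbour P a pa bad-a
    ...   | x , hax , y-rich = rematched , tt , improves poor pa (inj₁ y-rich)
      where open Improve P hax bad-a

    AllPoorGood : Pairing n → Set
    AllPoorGood P = ∀ v → poor v ≡ true → good P v ≡ true

    -- Phase 2 step: under the invariant, a badly paired vertex a and its partner b are both rich, so by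
    -- pigeonhole a has an H-neighbour x whose partner is an H-neighbour of b.
    crossing-neighbour : ∀ P → AllPoorGood P → ∀ a → good P a ≡ false →
                         ∃ λ x → h a x ≡ true × h (partner P a) (partner P x) ≡ true
    crossing-neighbour P ok a bad-a = pigeonhole (h a) (λ x → h b (partner P x)) many
      where
      b = partner P a
      bad-b : good P b ≡ false
      bad-b = trans (cong (h b) (involutive P a)) (trans (Defs.sym H b a) bad-a)
      rich : ∀ {v} → good P v ≡ false → n < 2 * deg H v
      rich {v} bad-v = rich⇒ (¬-not (λ pv → true≢false (trans (sym (ok v pv)) bad-v)))
      many : n < # (h a) + # (λ x → h b (partner P x))
      many = subst₂ (λ da db → n < da + db) (deg≡degree H a) (trans (deg≡degree H b) (sym (∑-partner P (𝟙 ∘ h b))))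
               (rich-pair {a = deg H a} {b = deg H b} (rich bad-a) (rich bad-b))

    phase₂-step : ∀ P → AllPoorGood P → 0 < defect (λ _ → true) P →
                  ∃ λ P′ → AllPoorGood P′ × defect (λ _ → true) P′ < defect (λ _ → true) P
    phase₂-step P ok pos with defect-positive (λ _ → true) P pos
    ... | a , _ , bad-a with crossing-neighbour P ok a bad-a
    ...   | x , hax , hby = rematched , ok′ , improves (λ _ → true) refl (inj₂ hby)
      where
      open Improve P hax bad-a
      ok′ : AllPoorGood rematched
      ok′ v pv with v ≟ partner P x
      ... | yes refl = y-good hby
      ... | no v≢y = keeps-good v v≢y (ok v pv)

    perfect-matching : Σ (Graph n) λ M → IsPerfectMatching H M
    perfect-matching = pairs P₂ , pairing⇒perfect-matching H P₂ (λ v → all-good v refl)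
      where
      phase₁ = descend (defect poor) (λ _ → ⊤) phase₁-step P₀ tt
      P₁ = proj₁ phase₁
      phase₂ = descend (defect (λ _ → true)) AllPoorGood phase₂-step P₁ (defect-zero poor P₁ (proj₂ (proj₂ phase₁)))
      P₂ = proj₁ phase₂
      all-good = defect-zero (λ _ → true) P₂ (proj₂ (proj₂ phase₂))

module PreclusionNumber where

  open import Data.Nat using (ℕ; zero; suc; _+_; _*_; _≤_; _≤?_)
  open import Data.Nat.Properties hiding (_≟_)
  open import Data.Fin using (Fin; zero; suc)
  open import Data.Product using (∃; _,_; proj₁; proj₂)
  open import Data.Sum using (_⊎_; inj₁; inj₂)
  open import Data.Empty using (⊥-elim)
  open import Function using (_∘_)
  open import Relation.Nullary using (¬_; yes; no)
  open import Relation.Binary.PropositionalEquality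
  open import Defs hiding (sym)
  open Pairings
  open Matchings
  open RobustMatching

  minimum : ∀ {n} (f : Fin n → ℕ) → ¬ Fin n ⊎ ∃ λ v → ∀ w → f v ≤ f w
  minimum {zero} f = inj₁ (λ ())
  minimum {suc n} f with minimum (f ∘ suc)
  ... | inj₁ empty = inj₂ (zero , λ { zero → ≤-refl ; (suc w) → ⊥-elim (empty w) })
  ... | inj₂ (v , v-min) with f zero ≤? f (suc v)
  ...   | yes f0≤ = inj₂ (zero , λ { zero → ≤-refl ; (suc w) → ≤-trans f0≤ (v-min w) })
  ...   | no f0≰ = inj₂ (suc v , λ { zero → <⇒≤ (≰⇒> f0≰) ; (suc w) → v-min w })

  mp-unique : ∀ {n} {G : Graph n} {m m′} → IsMatchingPreclusionNumber G m → IsMatchingPreclusionNumber G m′ → m ≡ m′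
  mp-unique ((H , H⊆G , none , cost) , m-least) ((H′ , H′⊆G , none′ , cost′) , m′-least) =
    ≤-antisym (subst (_ ≤_) cost′ (m-least H′ H′⊆G none′)) (subst (_ ≤_) cost (m′-least H H⊆G none))

  module _ {n : ℕ} (P₀ : Pairing n) (G : Graph n) where

    -- Isolating a vertex destroys all perfect and almost-perfect matchings (n being even).
    isolate-destroys : ∀ v → ¬ HasPMorAPM (isolate G v)
    isolate-destroys v (M , inj₁ pm) = isolated⇒no-PM (isolate G v) v (isolate-isolated G v) M pm
    isolate-destroys v (M , inj₂ apm) = paired⇒no-APM P₀ (isolate G v) M apm

    deletions-needed : ∀ {δ} → (∀ v → δ ≤ deg G v) → 3 * n + 6 ≤ 4 * δ →
                       ∀ H → H ⊆ᴳ G → ¬ HasPMorAPM H → δ ≤ deletedEdges G H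
    deletions-needed {δ} min-deg dense H H⊆G none with δ ≤? deletedEdges G H
    ... | yes enough = enough
    ... | no too-few = ⊥-elim (none (M , inj₁ M-perfect))
      where
      open Robust P₀ {G} {H} H⊆G min-deg dense (≰⇒> too-few) using (perfect-matching)
      M = proj₁ perfect-matching
      M-perfect = proj₂ perfect-matching

    mp-of-min-degree : ∀ v → (∀ w → deg G v ≤ deg G w) → 3 * n + 6 ≤ 4 * deg G v →
                       IsMatchingPreclusionNumber G (deg G v)
    mp-of-min-degree v v-min dense =
      (isolate G v , isolate-⊆ G v , isolate-destroys v , isolate-cost G v) , deletions-needed v-min dense

    min-degree⇒mp : ∀ {m} → 3 * n + 6 ≤ 4 * m → IsMinDegree G m → IsMatchingPreclusionNumber G m
    min-degree⇒mp dense ((v , deg≡m) , m-min) =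
      subst (IsMatchingPreclusionNumber G) deg≡m
        (mp-of-min-degree v (λ w → subst (_≤ deg G w) (sym deg≡m) (m-min w)) (subst (λ d → 3 * n + 6 ≤ 4 * d) (sym deg≡m) dense))

    -- Conversely, mp(G) = m ≤ δ(G) (isolate a vertex), so the density hypothesis holds for δ(G) and
    -- mp(G) = δ(G) = m. With no vertices, every graph has the empty perfect matching.
    mp⇒min-degree : ∀ {m} → 3 * n + 6 ≤ 4 * m → IsMatchingPreclusionNumber G m → IsMinDegree G m
    mp⇒min-degree {m} dense mp@((H , _ , none , _) , m-least) with minimum (deg G)
    ... | inj₁ empty = ⊥-elim (none (pairs P₀ , inj₁ (pairing⇒perfect-matching H P₀ (⊥-elim ∘ empty))))
    ... | inj₂ (v , v-min) = (v , sym m≡deg) , λ w → subst (_≤ deg G w) (sym m≡deg) (v-min w)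
      where
      m≤deg : m ≤ deg G v
      m≤deg = subst (m ≤_) (isolate-cost G v) (m-least (isolate G v) (isolate-⊆ G v) (isolate-destroys v))
      m≡deg : m ≡ deg G v
      m≡deg = mp-unique {G = G} mp (mp-of-min-degree v v-min (≤-trans dense (*-monoʳ-≤ 4 m≤deg)))


open import Defs using (Graph; IsMatchingPreclusionNumber; IsMinDegree)
open import Data.Nat using (ℕ)
open import Data.Nat.Divisibility using (_∣_; divides)
open import Data.Integer using (ℤ; +_; _-_; _+_; _*_; _≤_)
open import Data.Integer.Properties using (pos-+; pos-*; +-monoˡ-≤; drop‿+≤+; module ≤-Reasoning)
open import Data.Integer.Tactic.RingSolver using (solve-∀)
open import Function.Bundles using (_⇔_; mk⇔)
open import Relation.Binary.PropositionalEquality using (_≡_; refl; sym; trans; cong; subst)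
import Data.Nat as ℕ
import Data.Nat.Properties as ℕ
open Pairings using (Pairing; standard-pairing)
open PreclusionNumber using (mp⇒min-degree; min-degree⇒mp)

density : ∀ n m (k : ℤ) → + 4 * k + + 6 ≤ + n → + m ≡ + n - k → 3 ℕ.* n ℕ.+ 6 ℕ.≤ 4 ℕ.* m
density n m k n≥4k+6 m≡n-k = ℕ.+-cancelˡ-≤ n (3 ℕ.* n ℕ.+ 6) (4 ℕ.* m) (drop‿+≤+ (begin
  + (n ℕ.+ (3 ℕ.* n ℕ.+ 6))         ≡⟨ cong +_ (solve 1 (λ n → n :+ (con 3 :* n :+ con 6) := con 4 :* n :+ con 6) refl n) ⟩
  + (4 ℕ.* n ℕ.+ 6)                 ≡⟨ trans (pos-+ (4 ℕ.* n) 6) (cong (_+ + 6) (pos-* 4 n)) ⟩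
  + 4 * + n + + 6                   ≡⟨ rearrange k (+ n) ⟩
  (+ 4 * k + + 6) + + 4 * (+ n - k) ≤⟨ +-monoˡ-≤ (+ 4 * (+ n - k)) n≥4k+6 ⟩
  + n + + 4 * (+ n - k)             ≡⟨ cong (λ z → + n + + 4 * z) m≡n-k ⟨
  + n + + 4 * + m                   ≡⟨ trans (pos-+ n (4 ℕ.* m)) (cong (λ z → + n + z) (pos-* 4 m)) ⟨
  + (n ℕ.+ 4 ℕ.* m)                 ∎))
  where
  open ≤-Reasoning
  open import Data.Nat.Solver using (module +-*-Solver)
  open +-*-Solver using (solve; _:+_; _:*_; _:=_; con)
  rearrange : ∀ (k n : ℤ) → + 4 * n + + 6 ≡ (+ 4 * k + + 6) + + 4 * (n - k)
  rearrange = solve-∀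

theorem3p6 : (n : ℕ) (k : ℤ) → (+ 4) * k + (+ 6) ≤ + n → 2 ∣ n → (G : Graph n) →
    ((m : ℕ) → + m ≡ + n - k → IsMatchingPreclusionNumber G m ⇔ IsMinDegree G m)
theorem3p6 n k n≥4k+6 (divides q n≡q*2) G m m≡n-k = mk⇔ (mp⇒min-degree P₀ G dense) (min-degree⇒mp P₀ G dense)
  where
  P₀ : Pairing n
  P₀ = subst Pairing (sym n≡q*2) (standard-pairing q)
  dense : 3 ℕ.* n ℕ.+ 6 ℕ.≤ 4 ℕ.* m
  dense = density n m k n≥4k+6 m≡n-k
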